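{- Define graphs $H_0,H_1,\dots$ recursively: $H_0$ is a single vertex; for $k\ge1$, $H_k$ consists of a complete graph $K_{2^{k+1}-1}$ with vertices numbered $1,\dots,2^{k+1}-1$, together with $2^{k+1}-1$ disjoint copies of $H_{k-1}$, where for each $i$ the $i$-th vertex of the clique is joined by an edge to one vertex of the $i$-th copy of $H_{k-1}$. Then for every $k\ge0$, $\chi_{um}(H_k)\le 2^{k+2}-k-3$.
   Context: A path is a simple path (a single vertex counts). A unique-maximum coloring of a graph with $k$ colors is a map from its vertices to $\{1,\dots,k\}$ such that on every path the maximum color occurs exactly once; $\chi_{um}$ is the minimum such $k$. -}

module Defs where

open import Data.Nat using (ℕ; zero; suc; _+_; _∸_; _^_; _≤_; _⊔_)
open import Data.Nat.Properties using (_≟_)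
open import Data.Fin using (Fin)
open import Data.Unit using (⊤)
open import Data.Empty using (⊥)
open import Data.Product using (Σ; _×_; _,_; proj₁; proj₂)
open import Data.Sum using (_⊎_; inj₁; inj₂)
open import Data.List using (List; []; _∷_; map; foldr; filter; length)
open import Data.List.Relation.Unary.Linked using (Linked)
open import Data.List.Relation.Unary.Unique.Propositional using (Unique)
open import Relation.Binary.PropositionalEquality using (_≡_; _≢_)

-- Size of the clique of H_(k+1):  2^((k+1)+1) - 1
cliqueSize : ℕ → ℕ
cliqueSize k = 2 ^ (k + 2) ∸ 1

V : ℕ → Set
V zero    = ⊤
V (suc k) = Fin (cliqueSize k) ⊎ (Fin (cliqueSize k) × V k)

-- The construction depends on which vertex of each copy is joined to the
-- clique.  A choice records, for every copy i, the choices inside that copy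
-- and the attachment vertex of that copy.  The theorem quantifies over all
-- choices.
Choice : ℕ → Set
Choice zero    = ⊤
Choice (suc k) = Fin (cliqueSize k) → Choice k × V k

Adj : (k : ℕ) → Choice k → V k → V k → Set
Adj zero    _  _ _ = ⊥
Adj (suc k) ch (inj₁ i)       (inj₁ j)       = i ≢ j
Adj (suc k) ch (inj₁ i)       (inj₂ (j , v)) = (i ≡ j) × (v ≡ proj₂ (ch j))
Adj (suc k) ch (inj₂ (i , u)) (inj₁ j)       = (i ≡ j) × (u ≡ proj₂ (ch i))
Adj (suc k) ch (inj₂ (i , u)) (inj₂ (j , v)) = (i ≡ j) × Adj k (proj₁ (ch i)) u v

record IsPath {A : Set} (R : A → A → Set) (p : List A) : Set where
  field
    nonempty : p ≢ []
    distinct : Unique p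
    linked   : Linked R p

maxColour : {A : Set} → (A → ℕ) → List A → ℕ
maxColour c p = foldr _⊔_ 0 (map c p)

countMax : {A : Set} → (A → ℕ) → List A → ℕ
countMax c p = length (filter (λ v → c v ≟ maxColour c p) p)

IsUMColouring : {A : Set} → (A → A → Set) → ℕ → (A → ℕ) → Set
IsUMColouring {A} R n c =
  ((v : A) → (1 ≤ c v) × (c v ≤ n)) ×
  ((p : List A) → IsPath R p → countMax c p ≡ 1)

χum≤ : {A : Set} → (A → A → Set) → ℕ → Set
χum≤ {A} R n = Σ (A → ℕ) (IsUMColouring R n)

-- Colour H₀ with 1 and, in H_{k+1}, reuse the colouring of H_k on every copy while giving
-- the clique vertices fresh, pairwise distinct colours above all of these.  On any walk the
-- largest colour is then attained exactly once: either it sits on a clique vertex, whose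
-- colour is unique in the whole graph, or every vertex of the walk lies in the copies;
-- since copies meet only through the clique, the walk then stays inside one copy and
-- induction applies.  The number of colours c_k satisfies c₀ = 1 and
-- c_{k+1} = c_k + 2^{k+2} − 1, which solves to 2^{k+2} − k − 3.
module Submission where

open import Defs
open import Data.Nat using (ℕ; zero; suc; _+_; _∸_; _^_; _≤_; _<_; z≤n; s≤s)
open import Data.Nat.Properties
open import Data.Nat.Tactic.RingSolver using (solve-∀)
open import Data.Fin using (Fin; toℕ)
open import Data.Fin.Properties using (toℕ<n; toℕ-injective)
open import Data.Unit using (⊤; tt)
open import Data.Empty using (⊥; ⊥-elim)
open import Data.Product using (_×_; _,_; proj₁; proj₂; ∃-syntax)
open import Data.Sum using (inj₁; inj₂; [_,_]′)
open import Data.List using (List; []; _∷_; map; filter; length)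
open import Data.List.Properties using (filter-accept; filter-reject; filter-none)
open import Data.List.Extrema.Nat using (argmax; argmax-sel; f[⊥]≤f[argmax]; f[xs]≤f[argmax])
open import Data.List.Relation.Unary.All as All using (All; []; _∷_)
open import Data.List.Relation.Unary.All.Properties using (map⁺)
open import Data.List.Relation.Unary.Any using (here; there)
open import Data.List.Relation.Unary.Linked using (Linked; [-]; _∷_)
open import Data.List.Relation.Unary.AllPairs using (_∷_)
open import Data.List.Relation.Unary.Unique.Propositional using (Unique)
open import Data.List.Membership.Propositional using (_∈_)
open import Data.List.Membership.Propositional.Properties using (∈-map⁺)
open import Function using (_∘_)
open import Relation.Nullary using (Dec)
open import Relation.Binary.PropositionalEquality
  using (_≡_; _≢_; refl; sym; cong; cong₂; module ≡-Reasoning)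

module _ {A : Set} (c : A → ℕ) where

  UniqueMaximum : List A → Set
  UniqueMaximum p =
    ∃[ v ] v ∈ p × All (λ u → c u ≤ c v) p × All (λ u → c u ≡ c v → u ≡ v) p

  maximum : (x : A) (xs : List A) →
    ∃[ v ] v ∈ x ∷ xs × All (λ u → c u ≤ c v) (x ∷ xs)
  maximum x xs =
    argmax c x xs ,
    [ here , there ]′ (argmax-sel c x xs) ,
    f[⊥]≤f[argmax] {f = c} x xs ∷ f[xs]≤f[argmax] {f = c} x xs

  maxColour-lub : ∀ {m} p → All (λ u → c u ≤ m) p → maxColour c p ≤ m
  maxColour-lub []       []           = z≤n
  maxColour-lub (_ ∷ p) (cx≤m ∷ cp≤m) = ⊔-lub cx≤m (maxColour-lub p cp≤m)

  maxColour-upper : ∀ {v p} → v ∈ p → c v ≤ maxColour c p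
  maxColour-upper {p = x ∷ p} (here refl) = m≤m⊔n (c x) (maxColour c p)
  maxColour-upper {p = x ∷ p} (there v∈p) = ≤-trans (maxColour-upper v∈p) (m≤n⊔m (c x) _)

  count-uniqueMaximum : ∀ {v p} → Unique p → v ∈ p → All (λ u → c u ≡ c v → u ≡ v) p →
    length (filter (λ u → c u ≟ c v) p) ≡ 1
  count-uniqueMaximum {v} {x ∷ p} (x∉p ∷ _) (here refl) (_ ∷ only) = begin
    length (filter colour-v? (x ∷ p)) ≡⟨ cong length (filter-accept colour-v? refl) ⟩
    suc (length (filter colour-v? p)) ≡⟨ cong (suc ∘ length) (filter-none colour-v? others) ⟩
    1                                 ∎
    where
    open ≡-Reasoning
    colour-v? : (u : A) → Dec (c u ≡ c v)
    colour-v? u = c u ≟ c v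
    others : All (λ u → c u ≢ c x) p
    others = All.zipWith (λ { (x≢u , only-u) → x≢u ∘ sym ∘ only-u }) (x∉p , only)
  count-uniqueMaximum {v} {x ∷ p} (x∉p ∷ unique) (there v∈p) (only-x ∷ only)
    rewrite filter-reject (λ u → c u ≟ c v) {x} {p} (All.lookup x∉p v∈p ∘ only-x) =
      count-uniqueMaximum unique v∈p only

  countMax-uniqueMaximum : ∀ {p} → Unique p → UniqueMaximum p → countMax c p ≡ 1
  countMax-uniqueMaximum {p} unique (v , v∈p , below , only)
    rewrite ≤-antisym (maxColour-lub p below) (maxColour-upper v∈p) =
      count-uniqueMaximum unique v∈p only

uniqueMaximum-map : ∀ {A B : Set} (c : B → ℕ) (f : A → B) {q} →
  UniqueMaximum (c ∘ f) q → UniqueMaximum c (map f q)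
uniqueMaximum-map c f (v , v∈q , below , only) =
  f v , ∈-map⁺ f v∈q , map⁺ below , map⁺ (All.map (λ only-u → cong f ∘ only-u) only)

colours : ℕ → ℕ
colours zero    = 1
colours (suc k) = colours k + cliqueSize k

colour : (k : ℕ) → Choice k → V k → ℕ
colour zero    _  _              = 1
colour (suc k) _  (inj₁ i)       = colours k + suc (toℕ i)
colour (suc k) ch (inj₂ (i , w)) = colour k (proj₁ (ch i)) w

colour-range : ∀ k ch v → 1 ≤ colour k ch v × colour k ch v ≤ colours k
colour-range zero    _  _              = ≤-refl , ≤-refl
colour-range (suc k) _  (inj₁ i)       =
  ≤-trans (s≤s z≤n) (m≤n+m _ (colours k)) , +-monoʳ-≤ (colours k) (toℕ<n i)
colour-range (suc k) ch (inj₂ (i , w)) =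
  proj₁ (colour-range k (proj₁ (ch i)) w) ,
  ≤-trans (proj₂ (colour-range k (proj₁ (ch i)) w)) (m≤m+n (colours k) (cliqueSize k))

colours<clique-colour : ∀ k ch i → colours k < colour (suc k) ch (inj₁ i)
colours<clique-colour k _ i = m<m+n (colours k) (s≤s z≤n)

clique-colour-unique : ∀ k ch u i →
  colour (suc k) ch u ≡ colour (suc k) ch (inj₁ i) → u ≡ inj₁ i
clique-colour-unique k ch (inj₁ j) i eq =
  cong inj₁ (toℕ-injective (suc-injective (+-cancelˡ-≡ (colours k) _ _ eq)))
clique-colour-unique k ch (inj₂ (j , w)) i eq =
  ⊥-elim (<⇒≱ (colours<clique-colour k ch i) (begin
    colour (suc k) ch (inj₁ i)     ≡⟨ sym eq ⟩
    colour k (proj₁ (ch j)) w      ≤⟨ proj₂ (colour-range k (proj₁ (ch j)) w) ⟩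
    colours k                      ∎))
  where open ≤-Reasoning

IsCopyVertex : ∀ {k} → V (suc k) → Set
IsCopyVertex (inj₁ _) = ⊥
IsCopyVertex (inj₂ _) = ⊤

low-colour⇒copy : ∀ k ch u → colour (suc k) ch u ≤ colours k → IsCopyVertex u
low-colour⇒copy k ch (inj₁ i) ≤colours = <⇒≱ (colours<clique-colour k ch i) ≤colours
low-colour⇒copy k ch (inj₂ _) _        = tt

inCopy : ∀ {k} → Fin (cliqueSize k) → V k → V (suc k)
inCopy i w = inj₂ (i , w)

copy-walk : ∀ {k ch} x xs → Linked (Adj (suc k) ch) (x ∷ xs) → All IsCopyVertex (x ∷ xs) →
  ∃[ i ] ∃[ w ] ∃[ ws ]
    x ∷ xs ≡ map (inCopy i) (w ∷ ws) × Linked (Adj k (proj₁ (ch i))) (w ∷ ws)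
copy-walk (inj₁ _)       _                     _                      (() ∷ _)
copy-walk (inj₂ _)       (inj₁ _ ∷ _)          _                      (_ ∷ () ∷ _)
copy-walk (inj₂ (i , w)) []                    _                      _ = i , w , [] , refl , [-]
copy-walk (inj₂ (i , w)) (inj₂ (.i , w′) ∷ ys) ((refl , w~w′) ∷ walk) (_ ∷ copies)
  with copy-walk (inj₂ (i , w′)) ys walk copies
... | .i , .w′ , ws , refl , walk′ = i , w , w′ ∷ ws , refl , w~w′ ∷ walk′

walk-uniqueMaximum : ∀ k ch x xs →
  Linked (Adj k ch) (x ∷ xs) → UniqueMaximum (colour k ch) (x ∷ xs)
walk-uniqueMaximum zero    ch x xs _ =
  x , here refl , All.tabulate (λ _ → ≤-refl) , All.tabulate (λ _ _ → refl)
walk-uniqueMaximum (suc k) ch x xs walk with maximum (colour (suc k) ch) x xs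
... | inj₁ i , i∈p , below =
  inj₁ i , i∈p , below , All.tabulate (λ {u} _ → clique-colour-unique k ch u i)
... | inj₂ (i , w) , _ , below
  with copy-walk x xs walk (All.map (λ {u} u≤w → low-colour⇒copy k ch u
         (≤-trans u≤w (proj₂ (colour-range k (proj₁ (ch i)) w)))) below)
...   | j , w′ , ws , refl , walk′ =
  uniqueMaximum-map (colour (suc k) ch) (inCopy j)
    (walk-uniqueMaximum k (proj₁ (ch j)) w′ ws walk′)

suc-cliqueSize : ∀ k → suc (cliqueSize k) ≡ 2 ^ (k + 2)
suc-cliqueSize k = m+[n∸m]≡n (m^n>0 2 (k + 2))

colours+k+3 : ∀ k → colours k + (k + 3) ≡ 2 ^ (k + 2)
colours+k+3 zero    = refl
colours+k+3 (suc k) = begin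
  colours k + cliqueSize k + (suc k + 3)  ≡⟨ regroup (colours k) (cliqueSize k) k ⟩
  colours k + (k + 3) + suc (cliqueSize k) ≡⟨ cong₂ _+_ (colours+k+3 k) (suc-cliqueSize k) ⟩
  2 ^ (k + 2) + 2 ^ (k + 2)               ≡⟨ cong (2 ^ (k + 2) +_) (sym (+-identityʳ _)) ⟩
  2 ^ (suc k + 2)                         ∎
  where
  open ≡-Reasoning
  regroup : ∀ a b k → a + b + (suc k + 3) ≡ a + (k + 3) + suc b
  regroup = solve-∀

colours≡ : ∀ k → colours k ≡ 2 ^ (k + 2) ∸ k ∸ 3
colours≡ k = sym (begin
  2 ^ (k + 2) ∸ k ∸ 3                 ≡⟨ ∸-+-assoc (2 ^ (k + 2)) k 3 ⟩
  2 ^ (k + 2) ∸ (k + 3)               ≡⟨ cong (_∸ (k + 3)) (sym (colours+k+3 k)) ⟩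
  colours k + (k + 3) ∸ (k + 3)       ≡⟨ m+n∸n≡m (colours k) (k + 3) ⟩
  colours k                           ∎)
  where open ≡-Reasoning

lemma3 : (k : ℕ) → (ch : Choice k) → χum≤ (Adj k ch) (2 ^ (k + 2) ∸ k ∸ 3)
lemma3 k ch rewrite sym (colours≡ k) = colour k ch , colour-range k ch , path-uniqueMaximum
  where
  path-uniqueMaximum : (p : List (V k)) → IsPath (Adj k ch) p → countMax (colour k ch) p ≡ 1
  path-uniqueMaximum []       path = ⊥-elim (IsPath.nonempty path refl)
  path-uniqueMaximum (x ∷ xs) path =
    countMax-uniqueMaximum (colour k ch) (IsPath.distinct path)
      (walk-uniqueMaximum k ch x xs (IsPath.linked path))
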